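{- In the setting described in the context, let $x_i$ and $x_j$ ($i<j$) be two occurrences of the same repeat in $\pi$ with distinct signs, and let $\pi'$ be obtained from $\pi$ by performing the symmetric reversal $\rho(i,j)$. Then $N_{MNS}[\pi]-N_{MNS}[\pi']\le 1$.
   Context: Fix genes $\Sigma_1$ and repeats $\Sigma_2\ni r_0$. A chromosome is a sequence $\pi=[x_0,\dots,x_{n+1}]$ of signed symbols ($x_i=\pm a$, $|x_i|=a$) with $x_0=+r_0$, $x_{n+1}=-r_0$, every gene occurring exactly once. A symmetric reversal $\rho(i,j)$ ($x_i=-x_j$) replaces $x_i,\dots,x_j$ by $-x_j,\dots,-x_i$. Nodes: $(l(x_i),r(x_i))=(a^h,a^t)$ if $x_i=+a$, $(a^t,a^h)$ if $x_i=-a$. Adjacencies: unordered pairs $\langle r(x_i),l(x_{i+1})\rangle$, $0\le i\le n$; $\mathcal{A}[\pi]$ is their multiset; $\pi$ is simple if no adjacency repeats. Setting: $\pi$ and $\tau=[y_0,\dots,y_{n+1}]$ are simple related chromosomes with $\mathcal{A}[\pi]=\mathcal{A}[\tau]$, every repeat occurring exactly twice in each, and $\tau$ containing both $+r$ and $-r$ for every repeat $r$. For a chromosome $\sigma$ with $\mathcal{A}[\sigma]=\mathcal{A}[\tau]$ (e.g. $\pi$ or $\pi'$), identical adjacencies are matched; an adjacency $\langle r(x_i),l(x_{i+1})\rangle$ of $\sigma$ matched to $\langle r(y_j),l(y_{j+1})\rangle$ is positive if $r(x_i)=r(y_j)\ne l(x_{i+1})=l(y_{j+1})$, negative if $r(x_i)=l(y_{j+1})\ne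 l(x_{i+1})=r(y_j)$, entangled if all four nodes coincide, and entangled adjacencies get the direction of their neighbours. $N_{MNS}[\sigma]$ is the number of maximal runs of consecutive negative adjacencies of $\sigma$. -}

module Defs where

open import Data.Bool using (Bool; true; false; not; _∧_; _∨_; if_then_else_)
open import Data.Nat using (ℕ; zero; suc; _+_; _<_; _≤_)
open import Data.Fin using (Fin) renaming (zero to fzero)
import Data.Fin as F
open import Data.List using (List; []; _∷_; _++_; [_]; take; drop; reverse; map; length)
open import Data.Maybe using (Maybe; just; nothing)
open import Data.Product using (_×_; _,_; ∃-syntax)
open import Relation.Nullary.Decidable using (⌊_⌋)
open import Relation.Binary.PropositionalEquality using (_≡_)
open import Data.List.Membership.Propositional using (_∈_)

-- Alphabet: G genes (Σ₁ = Fin G) and suc R repeats (Σ₂ = Fin (suc R)), r₀ = repeat 0.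
data Sym (G R : ℕ) : Set where
  gene : Fin G → Sym G R
  rep  : Fin (suc R) → Sym G R

module _ {G R : ℕ} where

  symEq : Sym G R → Sym G R → Bool
  symEq (gene a) (gene b) = ⌊ a F.≟ b ⌋
  symEq (rep a)  (rep b)  = ⌊ a F.≟ b ⌋
  symEq _ _ = false

  -- signed symbol: (true , a) = +a, (false , a) = -a
  Signed : Set
  Signed = Bool × Sym G R

  r₀ : Sym G R
  r₀ = rep fzero

  negS : Signed → Signed
  negS (s , a) = (not s , a)

  data End : Set where
    hd tl : End

  endEq : End → End → Bool
  endEq hd hd = true
  endEq tl tl = true
  endEq _ _ = false

  Node : Set
  Node = Sym G R × End

  nodeEq : Node → Node → Bool
  nodeEq (a , e) (b , f) = symEq a b ∧ endEq e f

  lN : Signed → Node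
  lN (true , a)  = (a , hd)
  lN (false , a) = (a , tl)

  rN : Signed → Node
  rN (true , a)  = (a , tl)
  rN (false , a) = (a , hd)

  -- adjacency ⟨r(x_i), l(x_{i+1})⟩ stored as an ordered pair (r(x_i), l(x_{i+1}))
  Adj : Set
  Adj = Node × Node

  adjs : List Signed → List Adj
  adjs (x ∷ y ∷ rest) = (rN x , lN y) ∷ adjs (y ∷ rest)
  adjs _ = []

  unordEq : Adj → Adj → Bool
  unordEq (u , v) (u' , v') = (nodeEq u u' ∧ nodeEq v v') ∨ (nodeEq u v' ∧ nodeEq v u')

  countAdj : Adj → List Adj → ℕ
  countAdj p [] = 0
  countAdj p (q ∷ qs) = if unordEq p q then suc (countAdj p qs) else countAdj p qs

  SameAdj : List Signed → List Signed → Set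
  SameAdj σ τ = ∀ (p : Adj) → countAdj p (adjs σ) ≡ countAdj p (adjs τ)

  Simple : List Signed → Set
  Simple σ = ∀ (p : Adj) → countAdj p (adjs σ) ≤ 1

  countSym : Sym G R → List Signed → ℕ
  countSym a [] = 0
  countSym a ((_ , b) ∷ xs) = if symEq a b then suc (countSym a xs) else countSym a xs

  IsChromosome : List Signed → Set
  IsChromosome σ =
    (∃[ mid ] σ ≡ (true , r₀) ∷ mid ++ [ (false , r₀) ])
    × (∀ (g : Fin G) → countSym (gene g) σ ≡ 1)

  lookupM : List Signed → ℕ → Maybe Signed
  lookupM [] _ = nothing
  lookupM (x ∷ xs) zero = just x
  lookupM (x ∷ xs) (suc i) = lookupM xs i

  reversal : ℕ → ℕ → List Signed → List Signed
  reversal i j σ =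
    take i σ ++ reverse (map negS (drop i (take (suc j) σ))) ++ drop (suc j) σ

  data Dir : Set where
    pos neg ent : Dir

  memOrd : Adj → List Adj → Bool
  memOrd p [] = false
  memOrd (u , v) ((u' , v') ∷ qs) = (nodeEq u u' ∧ nodeEq v v') ∨ memOrd (u , v) qs

  dirOf : List Adj → Adj → Dir
  dirOf aτ (u , v) =
    if nodeEq u v then ent
    else (if memOrd (u , v) aτ then pos
          else (if memOrd (v , u) aτ then neg else pos))

  isNeg : Dir → Bool
  isNeg neg = true
  isNeg _ = false

  -- entangled adjacencies take the direction of a neighbour:
  -- the (resolved) left neighbour if it exists, otherwise the right one.
  resolve : Maybe Bool → List Dir → List Bool
  resolve _ [] = []
  resolve (just b) (ent ∷ ds) = b ∷ resolve (just b) ds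
  resolve nothing (ent ∷ []) = false ∷ []
  resolve nothing (ent ∷ d ∷ ds) = isNeg d ∷ resolve (just (isNeg d)) (d ∷ ds)
  resolve _ (d ∷ ds) = isNeg d ∷ resolve (just (isNeg d)) ds

  runs : Bool → List Bool → ℕ
  runs prev [] = 0
  runs prev (true ∷ bs) = (if prev then 0 else 1) + runs true bs
  runs prev (false ∷ bs) = runs false bs

  NMNS : List Signed → List Signed → ℕ
  NMNS τ σ = runs false (resolve nothing (map (dirOf (adjs τ)) (adjs σ)))

-- Write π = A x B y C with y = -x, so ρ(i,j) gives π' = A x B̄ y C, where B̄ is B reversed with
-- all signs flipped.  The adjacencies of π' are those of π, except that the ones inside the
-- segment x B y occur in reverse order and read backwards.  As τ is simple with the same
-- adjacencies, each such adjacency occurs exactly once in τ, so reading it backwards swaps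
-- positive and negative (entangled ones stay entangled).  Hence the negativity sequence of π' is that of π with
-- one block reversed and complemented: this keeps the runs inside the block and can only merge
-- or split runs at the two ends of the block, losing at most one run.
module Submission where

open import Defs
open import Data.Bool using (Bool; true; false; not; _∧_; _∨_)
open import Data.Bool.Properties using (not-involutive; ∧-comm)
open import Data.Empty using (⊥; ⊥-elim)
open import Data.Fin using (Fin)
import Data.Fin as F
open import Data.List using (List; []; _∷_; _++_; [_]; take; drop; reverse; map; length)
open import Data.List.Properties
  using (++-assoc; ++-identityʳ; map-++; map-∘; map-cong-local; unfold-reverse; reverse-++; reverse-map)
open import Data.List.Membership.Propositional using (_∈_)
open import Data.List.Relation.Unary.All using (All; tabulate) renaming (map to All-map)
open import Data.List.Relation.Unary.All.Properties using (++⁻ˡ; ++⁻ʳ)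
open import Data.List.Relation.Unary.Any using (here; there)
open import Data.Maybe using (just; nothing)
open import Data.Nat using (ℕ; zero; suc; _+_; _<_; _≤_; z≤n; s≤s)
open import Data.Nat.Properties
  using (+-comm; +-assoc; +-identityʳ; +-suc; ≤-trans; ≤-reflexive; ≤-antisym;
         m≤m+n; m≤n+m; n≤1+n; +-monoʳ-≤; +-monoˡ-≤; module ≤-Reasoning)
open import Data.Product using (_×_; _,_; proj₁; swap; ∃-syntax)
open import Function using (_∘_)
open import Relation.Nullary using (yes; no; contradiction)
open import Relation.Binary.PropositionalEquality
  using (_≡_; refl; sym; trans; cong; cong₂; subst; subst₂; module ≡-Reasoning)

ind : Bool → ℕ
ind true  = 1
ind false = 0

ind-≤1 : ∀ b → ind b ≤ 1
ind-≤1 true  = s≤s z≤n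
ind-≤1 false = z≤n

rise : Bool → Bool → ℕ
rise x y = ind (not x ∧ y)

rises : List Bool → ℕ
rises (x ∷ y ∷ bs) = rise x y + rises (y ∷ bs)
rises _            = 0

rises-split : ∀ xs c ys → rises (xs ++ c ∷ ys) ≡ rises (xs ++ [ c ]) + rises (c ∷ ys)
rises-split []           c ys = refl
rises-split (x ∷ [])     c ys = cong (_+ rises (c ∷ ys)) (sym (+-identityʳ (rise x c)))
rises-split (x ∷ y ∷ xs) c ys =
  trans (cong (rise x y +_) (rises-split (y ∷ xs) c ys)) (sym (+-assoc (rise x y) _ _))

rises-true-∷ : ∀ bs → rises (true ∷ bs) ≡ rises bs
rises-true-∷ []       = refl
rises-true-∷ (_ ∷ _) = refl

rises-∷-≤ : ∀ b bs → rises (b ∷ bs) ≤ suc (rises bs)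
rises-∷-≤ b []       = z≤n
rises-∷-≤ b (c ∷ cs) = +-monoˡ-≤ (rises (c ∷ cs)) (ind-≤1 (not b ∧ c))

rises-≤-∷ : ∀ b bs → rises bs ≤ rises (b ∷ bs)
rises-≤-∷ b []       = z≤n
rises-≤-∷ b (c ∷ cs) = m≤n+m (rises (c ∷ cs)) (rise b c)

mirror : List Bool → List Bool
mirror bs = map not (reverse bs)

mirror-∷ : ∀ b bs → mirror (b ∷ bs) ≡ mirror bs ++ [ not b ]
mirror-∷ b bs = trans (cong (map not) (unfold-reverse b bs)) (map-++ not (reverse bs) [ b ])

mirror-∷ʳ : ∀ bs b → mirror (bs ++ [ b ]) ≡ not b ∷ mirror bs
mirror-∷ʳ bs b = cong (map not) (reverse-++ bs [ b ])

rise-not : ∀ x y → rise (not y) (not x) ≡ rise x y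
rise-not true  true  = refl
rise-not true  false = refl
rise-not false true  = refl
rise-not false false = refl

rises-mirror : ∀ bs → rises (mirror bs) ≡ rises bs
rises-mirror []           = refl
rises-mirror (x ∷ [])     = refl
rises-mirror (x ∷ y ∷ bs) = begin
    rises (mirror (x ∷ y ∷ bs))
  ≡⟨ cong rises (mirror-∷ x (y ∷ bs)) ⟩
    rises (mirror (y ∷ bs) ++ [ not x ])
  ≡⟨ cong (λ zs → rises (zs ++ [ not x ])) (mirror-∷ y bs) ⟩
    rises ((mirror bs ++ [ not y ]) ++ [ not x ])
  ≡⟨ cong rises (++-assoc (mirror bs) [ not y ] [ not x ]) ⟩
    rises (mirror bs ++ not y ∷ [ not x ])
  ≡⟨ rises-split (mirror bs) (not y) [ not x ] ⟩
    rises (mirror bs ++ [ not y ]) + (rise (not y) (not x) + 0)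
  ≡⟨ cong₂ _+_ (trans (cong rises (sym (mirror-∷ y bs))) (rises-mirror (y ∷ bs)))
               (trans (+-identityʳ _) (rise-not x y)) ⟩
    rises (y ∷ bs) + rise x y
  ≡⟨ +-comm (rises (y ∷ bs)) (rise x y) ⟩
    rises (x ∷ y ∷ bs)
  ∎
  where open ≡-Reasoning

rises-∷ʳ : ∀ bs b → rises (bs ++ [ b ]) ≡ rises (not b ∷ mirror bs)
rises-∷ʳ bs b = trans (sym (rises-mirror (bs ++ [ b ]))) (cong rises (mirror-∷ʳ bs b))

rises-∷ʳ-false : ∀ bs → rises (bs ++ [ false ]) ≡ rises bs
rises-∷ʳ-false bs = trans (rises-∷ʳ bs false) (trans (rises-true-∷ (mirror bs)) (rises-mirror bs))

rises-∷ʳ-≤ : ∀ bs b → rises (bs ++ [ b ]) ≤ suc (rises bs)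
rises-∷ʳ-≤ bs b =
  subst₂ _≤_ (sym (rises-∷ʳ bs b)) (cong suc (rises-mirror bs)) (rises-∷-≤ (not b) (mirror bs))

rises-≤-∷ʳ : ∀ bs b → rises bs ≤ rises (bs ++ [ b ])
rises-≤-∷ʳ bs b =
  subst₂ _≤_ (rises-mirror bs) (sym (rises-∷ʳ bs b)) (rises-≤-∷ (not b) (mirror bs))

rises-ends : ∀ u M s → rises (u ∷ M ++ [ s ]) ≤ suc (rises (not s ∷ M ++ [ not u ]))
rises-ends false M true  = n≤1+n _
rises-ends true  M s     = begin
  rises (true ∷ M ++ [ s ])                   ≡⟨ rises-true-∷ (M ++ [ s ]) ⟩
  rises (M ++ [ s ])                          ≤⟨ rises-∷ʳ-≤ M s ⟩
  suc (rises M)                               ≤⟨ s≤s (rises-≤-∷ʳ M false) ⟩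
  suc (rises (M ++ [ false ]))                ≤⟨ s≤s (rises-≤-∷ (not s) (M ++ [ false ])) ⟩
  suc (rises (not s ∷ M ++ [ false ]))        ∎
  where open ≤-Reasoning
rises-ends false M false = begin
  rises (false ∷ M ++ [ false ])              ≡⟨ rises-∷ʳ-false (false ∷ M) ⟩
  rises (false ∷ M)                           ≤⟨ rises-∷-≤ false M ⟩
  suc (rises M)                               ≤⟨ s≤s (rises-≤-∷ʳ M true) ⟩
  suc (rises (M ++ [ true ]))                 ≤⟨ s≤s (rises-≤-∷ true (M ++ [ true ])) ⟩
  suc (rises (true ∷ M ++ [ true ]))          ∎
  where open ≤-Reasoning

rises-mirror-between : ∀ u M s → rises (u ∷ mirror M ++ [ s ]) ≡ rises (not s ∷ M ++ [ not u ])
rises-mirror-between u M s = begin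
    rises (u ∷ mirror M ++ [ s ])
  ≡⟨ cong₂ (λ a b → rises (a ∷ mirror M ++ [ b ]))
           (sym (not-involutive u)) (sym (not-involutive s)) ⟩
    rises (not (not u) ∷ mirror M ++ [ not (not s) ])
  ≡⟨ cong (λ zs → rises (zs ++ [ not (not s) ])) (sym (mirror-∷ʳ M (not u))) ⟩
    rises (mirror (M ++ [ not u ]) ++ [ not (not s) ])
  ≡⟨ cong rises (sym (mirror-∷ (not s) (M ++ [ not u ]))) ⟩
    rises (mirror (not s ∷ M ++ [ not u ]))
  ≡⟨ rises-mirror (not s ∷ M ++ [ not u ]) ⟩
    rises (not s ∷ M ++ [ not u ])
  ∎
  where open ≡-Reasoning

rises-mirror-closed : ∀ u M s → rises (u ∷ M ++ [ s ]) ≤ suc (rises (u ∷ mirror M ++ [ s ]))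
rises-mirror-closed u M s =
  ≤-trans (rises-ends u M s) (≤-reflexive (cong suc (sym (rises-mirror-between u M s))))

rises-mirror-suffix : ∀ u M S → rises (u ∷ M ++ S) ≤ suc (rises (u ∷ mirror M ++ S))
rises-mirror-suffix u M [] = begin
    rises (u ∷ M ++ [])
  ≡⟨ cong (rises ∘ (u ∷_)) (++-identityʳ M) ⟩
    rises (u ∷ M)
  ≡⟨ sym (rises-∷ʳ-false (u ∷ M)) ⟩
    rises (u ∷ M ++ [ false ])
  ≤⟨ rises-mirror-closed u M false ⟩
    suc (rises (u ∷ mirror M ++ [ false ]))
  ≡⟨ cong suc (rises-∷ʳ-false (u ∷ mirror M)) ⟩
    suc (rises (u ∷ mirror M))
  ≡⟨ cong (suc ∘ rises ∘ (u ∷_)) (sym (++-identityʳ (mirror M))) ⟩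
    suc (rises (u ∷ mirror M ++ []))
  ∎
  where open ≤-Reasoning
rises-mirror-suffix u M (s ∷ S) = begin
    rises (u ∷ M ++ s ∷ S)
  ≡⟨ rises-split (u ∷ M) s S ⟩
    rises (u ∷ M ++ [ s ]) + rises (s ∷ S)
  ≤⟨ +-monoˡ-≤ (rises (s ∷ S)) (rises-mirror-closed u M s) ⟩
    suc (rises (u ∷ mirror M ++ [ s ]) + rises (s ∷ S))
  ≡⟨ cong suc (sym (rises-split (u ∷ mirror M) s S)) ⟩
    suc (rises (u ∷ mirror M ++ s ∷ S))
  ∎
  where open ≤-Reasoning

rises-mirror-infix : ∀ a P M S → rises (a ∷ P ++ M ++ S) ≤ suc (rises (a ∷ P ++ mirror M ++ S))
rises-mirror-infix a []      M S = rises-mirror-suffix a M S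
rises-mirror-infix a (p ∷ P) M S =
  ≤-trans (+-monoʳ-≤ (rise a p) (rises-mirror-infix p P M S)) (≤-reflexive (+-suc (rise a p) _))

take-++-length : ∀ {A : Set} (xs ys : List A) {n} → length xs ≡ n → take n (xs ++ ys) ≡ xs
take-++-length []       ys refl = refl
take-++-length (x ∷ xs) ys refl = cong (x ∷_) (take-++-length xs ys refl)

drop-++-length : ∀ {A : Set} (xs ys : List A) {n} → length xs ≡ n → drop n (xs ++ ys) ≡ ys
drop-++-length []       ys refl = refl
drop-++-length (x ∷ xs) ys refl = drop-++-length xs ys refl

module _ {G R : ℕ} where

  runs-rises : ∀ b bs → runs {G} {R} b bs ≡ rises (b ∷ bs)
  runs-rises b     []           = refl
  runs-rises false (true ∷ bs)  = cong suc (runs-rises true bs)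
  runs-rises true  (true ∷ bs)  = runs-rises true bs
  runs-rises false (false ∷ bs) = runs-rises false bs
  runs-rises true  (false ∷ bs) = runs-rises false bs

  negatives : List (Dir {G} {R}) → List Bool
  negatives []         = []
  negatives (pos ∷ ds) = false ∷ negatives ds
  negatives (neg ∷ ds) = true ∷ negatives ds
  negatives (ent ∷ ds) = negatives ds

  negatives-++ : ∀ ds es → negatives (ds ++ es) ≡ negatives ds ++ negatives es
  negatives-++ []         es = refl
  negatives-++ (pos ∷ ds) es = cong (false ∷_) (negatives-++ ds es)
  negatives-++ (neg ∷ ds) es = cong (true ∷_) (negatives-++ ds es)
  negatives-++ (ent ∷ ds) es = negatives-++ ds es

  -- An entangled adjacency takes the direction of a neighbour, so it neither starts nor ends a run.
  runs-resolve-just : ∀ b ds → runs {G} {R} b (resolve (just b) ds) ≡ runs {G} {R} b (negatives ds)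
  runs-resolve-just b     []         = refl
  runs-resolve-just true  (ent ∷ ds) = runs-resolve-just true ds
  runs-resolve-just false (ent ∷ ds) = runs-resolve-just false ds
  runs-resolve-just b     (pos ∷ ds) = runs-resolve-just false ds
  runs-resolve-just true  (neg ∷ ds) = runs-resolve-just true ds
  runs-resolve-just false (neg ∷ ds) = cong suc (runs-resolve-just true ds)

  runs-resolve : ∀ ds → runs {G} {R} false (resolve nothing ds) ≡ runs {G} {R} false (negatives ds)
  runs-resolve []               = refl
  runs-resolve (ent ∷ [])       = refl
  runs-resolve (ent ∷ ent ∷ ds) = runs-resolve-just false (ent ∷ ds)
  runs-resolve (ent ∷ pos ∷ ds) = runs-resolve-just false ds
  runs-resolve (ent ∷ neg ∷ ds) = cong suc (runs-resolve-just true ds)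
  runs-resolve (pos ∷ ds)       = runs-resolve-just false ds
  runs-resolve (neg ∷ ds)       = cong suc (runs-resolve-just true ds)

  flipD : Dir {G} {R} → Dir {G} {R}
  flipD pos = neg
  flipD neg = pos
  flipD ent = ent

  negatives-mirror : ∀ ds → negatives (reverse (map flipD ds)) ≡ mirror (negatives ds)
  negatives-mirror []       = refl
  negatives-mirror (d ∷ ds) = begin
      negatives (reverse (map flipD (d ∷ ds)))
    ≡⟨ cong negatives (unfold-reverse (flipD d) (map flipD ds)) ⟩
      negatives (reverse (map flipD ds) ++ [ flipD d ])
    ≡⟨ negatives-++ (reverse (map flipD ds)) [ flipD d ] ⟩
      negatives (reverse (map flipD ds)) ++ negatives [ flipD d ]
    ≡⟨ cong (_++ negatives [ flipD d ]) (negatives-mirror ds) ⟩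
      mirror (negatives ds) ++ negatives [ flipD d ]
    ≡⟨ last d ⟩
      mirror (negatives (d ∷ ds))
    ∎
    where
    open ≡-Reasoning
    last : ∀ d → mirror (negatives ds) ++ negatives [ flipD d ] ≡ mirror (negatives (d ∷ ds))
    last pos = sym (mirror-∷ false (negatives ds))
    last neg = sym (mirror-∷ true (negatives ds))
    last ent = ++-identityʳ (mirror (negatives ds))

  symEq-refl : ∀ (a : Sym G R) → symEq a a ≡ true
  symEq-refl (gene a) with a F.≟ a
  ... | yes _ = refl
  ... | no a≢a = contradiction refl a≢a
  symEq-refl (rep a) with a F.≟ a
  ... | yes _ = refl
  ... | no a≢a = contradiction refl a≢a

  symEq-sound : ∀ (a b : Sym G R) → symEq a b ≡ true → a ≡ b
  symEq-sound (gene a) (gene b) h with a F.≟ b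
  ... | yes refl = refl
  symEq-sound (gene a) (gene b) () | no _
  symEq-sound (rep a) (rep b) h with a F.≟ b
  ... | yes refl = refl
  symEq-sound (rep a) (rep b) () | no _

  nodeEq-refl : ∀ (u : Node {G} {R}) → nodeEq u u ≡ true
  nodeEq-refl (a , hd) rewrite symEq-refl a = refl
  nodeEq-refl (a , tl) rewrite symEq-refl a = refl

  nodeEq-sound : ∀ (u v : Node {G} {R}) → nodeEq u v ≡ true → u ≡ v
  nodeEq-sound (a , e) (b , f) h with symEq a b in a≡b
  nodeEq-sound (a , hd) (b , hd) h | true = cong (_, hd) (symEq-sound a b a≡b)
  nodeEq-sound (a , tl) (b , tl) h | true = cong (_, tl) (symEq-sound a b a≡b)

  nodeEq-sym : ∀ (u v : Node {G} {R}) → nodeEq u v ≡ nodeEq v u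
  nodeEq-sym u v with nodeEq u v in uv | nodeEq v u in vu
  ... | true  | true  = refl
  ... | false | false = refl
  ... | true  | false with refl ← nodeEq-sound u v uv = trans (sym (nodeEq-refl u)) vu
  ... | false | true  with refl ← nodeEq-sound v u vu = trans (sym uv) (nodeEq-refl u)

  sameOrd : Adj {G} {R} → Adj {G} {R} → Bool
  sameOrd (u , v) (u' , v') = nodeEq u u' ∧ nodeEq v v'

  sameOrd-sound : ∀ (p q : Adj {G} {R}) → sameOrd p q ≡ true → p ≡ q
  sameOrd-sound (u , v) (u' , v') h with nodeEq u u' in uu'
  ... | true = cong₂ _,_ (nodeEq-sound u u' uu') (nodeEq-sound v v' h)

  unordEq-sameOrd : ∀ (p q : Adj {G} {R}) → unordEq p q ≡ sameOrd p q ∨ sameOrd (swap p) q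
  unordEq-sameOrd (u , v) (u' , v') =
    cong (sameOrd (u , v) (u' , v') ∨_) (∧-comm (nodeEq u v') (nodeEq v u'))

  unordEq-refl : ∀ (p : Adj {G} {R}) → unordEq p p ≡ true
  unordEq-refl (u , v) rewrite nodeEq-refl u | nodeEq-refl v = refl

  countAdj-∷ : ∀ (p q : Adj {G} {R}) qs → countAdj p (q ∷ qs) ≡ ind (unordEq p q) + countAdj p qs
  countAdj-∷ p q qs with unordEq p q
  ... | true  = refl
  ... | false = refl

  countAdj-self : ∀ (q : Adj {G} {R}) qs → q ∈ qs → 1 ≤ countAdj q qs
  countAdj-self q (q ∷ qs) (here refl) = begin
    1                                     ≡⟨ cong ind (sym (unordEq-refl q)) ⟩
    ind (unordEq q q)                     ≤⟨ m≤m+n (ind (unordEq q q)) (countAdj q qs) ⟩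
    ind (unordEq q q) + countAdj q qs     ≡⟨ sym (countAdj-∷ q q qs) ⟩
    countAdj q (q ∷ qs)                   ∎
    where open ≤-Reasoning
  countAdj-self q (q' ∷ qs) (there q∈qs) = begin
    1                                     ≤⟨ countAdj-self q qs q∈qs ⟩
    countAdj q qs                         ≤⟨ m≤n+m (countAdj q qs) (ind (unordEq q q')) ⟩
    ind (unordEq q q') + countAdj q qs    ≡⟨ sym (countAdj-∷ q q' qs) ⟩
    countAdj q (q' ∷ qs)                  ∎
    where open ≤-Reasoning

  ∨-interleave : ∀ a b c d → (a ∨ b) ∨ (c ∨ d) ≡ (a ∨ c) ∨ (b ∨ d)
  ∨-interleave true  b     c d = refl
  ∨-interleave false b     false d = refl
  ∨-interleave false true  true  d = refl
  ∨-interleave false false true  d = refl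

  memOrd-either : ∀ (p : Adj {G} {R}) qs → 1 ≤ countAdj p qs →
    memOrd p qs ∨ memOrd (swap p) qs ≡ true
  memOrd-either p (q ∷ qs) h with unordEq p q in pq
  ... | true  = trans (∨-interleave (sameOrd p q) _ (sameOrd (swap p) q) _)
                      (cong (_∨ _) (trans (sym (unordEq-sameOrd p q)) pq))
  ... | false = trans (∨-interleave (sameOrd p q) _ (sameOrd (swap p) q) _)
                      (cong₂ _∨_ (trans (sym (unordEq-sameOrd p q)) pq) (memOrd-either p qs h))

  ind-∨-disjoint : ∀ a b c d {n} → (a ≡ true → c ≡ true → ⊥) → ind b + ind d ≤ n →
    ind (a ∨ b) + ind (c ∨ d) ≤ ind (a ∨ c) + n
  ind-∨-disjoint true  b true  d disj h = ⊥-elim (disj refl refl)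
  ind-∨-disjoint true  b false d disj h = s≤s (≤-trans (m≤n+m (ind d) (ind b)) h)
  ind-∨-disjoint false b true  d disj h =
    ≤-trans (≤-reflexive (+-comm (ind b) 1)) (s≤s (≤-trans (m≤m+n (ind b) (ind d)) h))
  ind-∨-disjoint false b false d disj h = h

  memOrd-both-≤ : ∀ (u v : Node {G} {R}) qs → nodeEq u v ≡ false →
    ind (memOrd (u , v) qs) + ind (memOrd (v , u) qs) ≤ countAdj (u , v) qs
  memOrd-both-≤ u v []       loop = z≤n
  memOrd-both-≤ u v (q ∷ qs) loop = begin
      ind (sameOrd (u , v) q ∨ memOrd (u , v) qs) + ind (sameOrd (v , u) q ∨ memOrd (v , u) qs)
    ≤⟨ ind-∨-disjoint (sameOrd (u , v) q) (memOrd (u , v) qs) (sameOrd (v , u) q) (memOrd (v , u) qs)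
                        disjoint (memOrd-both-≤ u v qs loop) ⟩
      ind (sameOrd (u , v) q ∨ sameOrd (v , u) q) + countAdj (u , v) qs
    ≡⟨ cong (λ b → ind b + countAdj (u , v) qs) (sym (unordEq-sameOrd (u , v) q)) ⟩
      ind (unordEq (u , v) q) + countAdj (u , v) qs
    ≡⟨ sym (countAdj-∷ (u , v) q qs) ⟩
      countAdj (u , v) (q ∷ qs)
    ∎
    where
    open ≤-Reasoning
    disjoint : sameOrd (u , v) q ≡ true → sameOrd (v , u) q ≡ true → ⊥
    disjoint uv vu
      with refl ← cong proj₁ (trans (sameOrd-sound (u , v) q uv) (sym (sameOrd-sound (v , u) q vu)))
      with () ← trans (sym loop) (nodeEq-refl u)

  dirOf-swap : ∀ aτ (q : Adj {G} {R}) → countAdj q aτ ≡ 1 →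
    dirOf aτ (swap q) ≡ flipD (dirOf aτ q)
  dirOf-swap aτ (u , v) once rewrite nodeEq-sym v u with nodeEq u v in loop
  ... | true = refl
  ... | false with memOrd (u , v) aτ in uv | memOrd (v , u) aτ in vu
  ...   | true  | false = refl
  ...   | false | true  = refl
  ...   | true  | true  = contradiction (subst₂ (λ a b → ind a + ind b ≤ 1) uv vu
                            (subst (ind (memOrd (u , v) aτ) + ind (memOrd (v , u) aτ) ≤_) once
                              (memOrd-both-≤ u v aτ loop))) λ { (s≤s ()) }
  ...   | false | false = contradiction (subst₂ (λ a b → a ∨ b ≡ true) uv vu
                            (memOrd-either (u , v) aτ (≤-reflexive (sym once)))) λ ()

  negativeFlags : List (Adj {G} {R}) → List (Adj {G} {R}) → List Bool
  negativeFlags aτ qs = negatives (map (dirOf aτ) qs)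

  NMNS-rises : ∀ (τ σ : List (Signed {G} {R})) →
    NMNS τ σ ≡ rises (false ∷ negativeFlags (adjs τ) (adjs σ))
  NMNS-rises τ σ =
    trans (runs-resolve (map (dirOf (adjs τ)) (adjs σ))) (runs-rises false (negativeFlags (adjs τ) (adjs σ)))

  negativeFlags-++ : ∀ aτ (xs ys : List (Adj {G} {R})) →
    negativeFlags aτ (xs ++ ys) ≡ negativeFlags aτ xs ++ negativeFlags aτ ys
  negativeFlags-++ aτ xs ys =
    trans (cong negatives (map-++ (dirOf aτ) xs ys)) (negatives-++ (map (dirOf aτ) xs) _)

  NMNS-split : ∀ (τ σ : List (Signed {G} {R})) P M S → adjs σ ≡ P ++ M ++ S →
    NMNS τ σ ≡ rises (false ∷ negativeFlags (adjs τ) P ++ negativeFlags (adjs τ) M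
                                ++ negativeFlags (adjs τ) S)
  NMNS-split τ σ P M S split = begin
      NMNS τ σ
    ≡⟨ NMNS-rises τ σ ⟩
      rises (false ∷ flags (adjs σ))
    ≡⟨ cong (rises ∘ (false ∷_) ∘ flags) split ⟩
      rises (false ∷ flags (P ++ M ++ S))
    ≡⟨ cong (rises ∘ (false ∷_))
            (trans (negativeFlags-++ (adjs τ) P (M ++ S))
                   (cong (flags P ++_) (negativeFlags-++ (adjs τ) M S))) ⟩
      rises (false ∷ flags P ++ flags M ++ flags S)
    ∎
    where
    open ≡-Reasoning
    flags = negativeFlags (adjs τ)

  negativeFlags-reverse : ∀ aτ (qs : List (Adj {G} {R})) → All (λ q → countAdj q aτ ≡ 1) qs →
    negativeFlags aτ (map swap (reverse qs)) ≡ mirror (negativeFlags aτ qs)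
  negativeFlags-reverse aτ qs once = begin
      negatives (map d (map swap (reverse qs)))
    ≡⟨ cong negatives (sym (map-∘ (reverse qs))) ⟩
      negatives (map (d ∘ swap) (reverse qs))
    ≡⟨ cong negatives (reverse-map (d ∘ swap) qs) ⟩
      negatives (reverse (map (d ∘ swap) qs))
    ≡⟨ cong (negatives ∘ reverse) (map-cong-local (All-map (dirOf-swap aτ _) once)) ⟩
      negatives (reverse (map (flipD ∘ d) qs))
    ≡⟨ cong (negatives ∘ reverse) (map-∘ qs) ⟩
      negatives (reverse (map flipD (map d qs)))
    ≡⟨ negatives-mirror (map d qs) ⟩
      mirror (negatives (map d qs))
    ∎
    where
    open ≡-Reasoning
    d = dirOf aτ

  occurs-once : ∀ {σ τ : List (Signed {G} {R})} → SameAdj σ τ → Simple τ →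
    All (λ q → countAdj q (adjs τ) ≡ 1) (adjs σ)
  occurs-once same simple =
    tabulate λ {q} q∈σ → ≤-antisym (simple q) (subst (1 ≤_) (same q) (countAdj-self q _ q∈σ))

  rN-negS : ∀ (z : Signed {G} {R}) → rN (negS z) ≡ lN z
  rN-negS (true , a)  = refl
  rN-negS (false , a) = refl

  lN-negS : ∀ (z : Signed {G} {R}) → lN (negS z) ≡ rN z
  lN-negS (true , a)  = refl
  lN-negS (false , a) = refl

  negS-involutive : ∀ (z : Signed {G} {R}) → negS (negS z) ≡ z
  negS-involutive (s , a) = cong (_, a) (not-involutive s)

  adjs-split : ∀ (xs : List (Signed {G} {R})) z ys →
    adjs (xs ++ z ∷ ys) ≡ adjs (xs ++ [ z ]) ++ adjs (z ∷ ys)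
  adjs-split []           z ys = refl
  adjs-split (x ∷ [])     z ys = refl
  adjs-split (x ∷ y ∷ xs) z ys = cong ((rN x , lN y) ∷_) (adjs-split (y ∷ xs) z ys)

  adjs-reverse : ∀ (xs : List (Signed {G} {R})) →
    adjs (reverse (map negS xs)) ≡ map swap (reverse (adjs xs))
  adjs-reverse []           = refl
  adjs-reverse (x ∷ [])     = refl
  adjs-reverse (x ∷ y ∷ xs) = begin
      adjs (reverse (map negS (x ∷ y ∷ xs)))
    ≡⟨ cong adjs (unfold-reverse (negS x) (map negS (y ∷ xs))) ⟩
      adjs (reverse (map negS (y ∷ xs)) ++ [ negS x ])
    ≡⟨ cong (λ zs → adjs (zs ++ [ negS x ])) (unfold-reverse (negS y) (map negS xs)) ⟩
      adjs ((ys′ ++ [ negS y ]) ++ [ negS x ])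
    ≡⟨ cong adjs (++-assoc ys′ [ negS y ] [ negS x ]) ⟩
      adjs (ys′ ++ negS y ∷ [ negS x ])
    ≡⟨ adjs-split ys′ (negS y) [ negS x ] ⟩
      adjs (ys′ ++ [ negS y ]) ++ [ (rN (negS y) , lN (negS x)) ]
    ≡⟨ cong₂ (λ zs q → adjs zs ++ [ q ]) (sym (unfold-reverse (negS y) (map negS xs)))
             (cong₂ _,_ (rN-negS y) (lN-negS x)) ⟩
      adjs (reverse (map negS (y ∷ xs))) ++ [ (lN y , rN x) ]
    ≡⟨ cong (_++ [ (lN y , rN x) ]) (adjs-reverse (y ∷ xs)) ⟩
      map swap (reverse (adjs (y ∷ xs))) ++ map swap [ (rN x , lN y) ]
    ≡⟨ sym (map-++ swap (reverse (adjs (y ∷ xs))) [ (rN x , lN y) ]) ⟩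
      map swap (reverse (adjs (y ∷ xs)) ++ [ (rN x , lN y) ])
    ≡⟨ cong (map swap) (sym (unfold-reverse (rN x , lN y) (adjs (y ∷ xs)))) ⟩
      map swap (reverse (adjs (x ∷ y ∷ xs)))
    ∎
    where
    open ≡-Reasoning
    ys′ = reverse (map negS xs)

  adjs-segment : ∀ (A : List (Signed {G} {R})) x B y C →
    adjs (A ++ (x ∷ B ++ [ y ]) ++ C) ≡ adjs (A ++ [ x ]) ++ adjs (x ∷ B ++ [ y ]) ++ adjs (y ∷ C)
  adjs-segment A x B y C = begin
      adjs (A ++ x ∷ (B ++ [ y ]) ++ C)
    ≡⟨ adjs-split A x ((B ++ [ y ]) ++ C) ⟩
      adjs (A ++ [ x ]) ++ adjs (x ∷ (B ++ [ y ]) ++ C)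
    ≡⟨ cong (λ zs → adjs (A ++ [ x ]) ++ adjs (x ∷ zs)) (++-assoc B [ y ] C) ⟩
      adjs (A ++ [ x ]) ++ adjs ((x ∷ B) ++ y ∷ C)
    ≡⟨ cong (adjs (A ++ [ x ]) ++_) (adjs-split (x ∷ B) y C) ⟩
      adjs (A ++ [ x ]) ++ adjs (x ∷ B ++ [ y ]) ++ adjs (y ∷ C)
    ∎
    where open ≡-Reasoning

  reversal-++ : ∀ (A W C : List (Signed {G} {R})) {i j} → length A ≡ i → length (A ++ W) ≡ suc j →
    reversal i j (A ++ W ++ C) ≡ A ++ reverse (map negS W) ++ C
  reversal-++ A W C {i} {j} lenA lenAW =
    cong₂ _++_ (take-++-length A (W ++ C) lenA)
               (cong₂ (λ V D → reverse (map negS V) ++ D) segment suffix)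
    where
    open ≡-Reasoning
    segment : drop i (take (suc j) (A ++ W ++ C)) ≡ W
    segment = begin
      drop i (take (suc j) (A ++ W ++ C))   ≡⟨ cong (drop i ∘ take (suc j)) (sym (++-assoc A W C)) ⟩
      drop i (take (suc j) ((A ++ W) ++ C)) ≡⟨ cong (drop i) (take-++-length (A ++ W) C lenAW) ⟩
      drop i (A ++ W)                       ≡⟨ drop-++-length A W lenA ⟩
      W                                     ∎
    suffix : drop (suc j) (A ++ W ++ C) ≡ C
    suffix = trans (cong (drop (suc j)) (sym (++-assoc A W C))) (drop-++-length (A ++ W) C lenAW)

  reverse-segment : ∀ (x : Signed {G} {R}) B →
    reverse (map negS (x ∷ B ++ [ negS x ])) ≡ x ∷ reverse (map negS B) ++ [ negS x ]
  reverse-segment x B = begin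
      reverse (map negS (x ∷ B ++ [ negS x ]))
    ≡⟨ unfold-reverse (negS x) (map negS (B ++ [ negS x ])) ⟩
      reverse (map negS (B ++ [ negS x ])) ++ [ negS x ]
    ≡⟨ cong (λ zs → reverse zs ++ [ negS x ]) (map-++ negS B [ negS x ]) ⟩
      reverse (map negS B ++ [ negS (negS x) ]) ++ [ negS x ]
    ≡⟨ cong (_++ [ negS x ]) (reverse-++ (map negS B) [ negS (negS x) ]) ⟩
      negS (negS x) ∷ reverse (map negS B) ++ [ negS x ]
    ≡⟨ cong (λ z → z ∷ reverse (map negS B) ++ [ negS x ]) (negS-involutive x) ⟩
      x ∷ reverse (map negS B) ++ [ negS x ]
    ∎
    where open ≡-Reasoning

  adjs-reversal : ∀ (A : List (Signed {G} {R})) x B C {i j} → length A ≡ i →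
    length (A ++ x ∷ B ++ [ negS x ]) ≡ suc j →
    adjs (reversal i j (A ++ (x ∷ B ++ [ negS x ]) ++ C))
      ≡ adjs (A ++ [ x ]) ++ map swap (reverse (adjs (x ∷ B ++ [ negS x ]))) ++ adjs (negS x ∷ C)
  adjs-reversal A x B C {i} {j} lenA lenAW = begin
      adjs (reversal i j (A ++ segment ++ C))
    ≡⟨ cong adjs (reversal-++ A segment C lenA lenAW) ⟩
      adjs (A ++ reverse (map negS segment) ++ C)
    ≡⟨ cong (λ zs → adjs (A ++ zs ++ C)) (reverse-segment x B) ⟩
      adjs (A ++ (x ∷ reverse (map negS B) ++ [ negS x ]) ++ C)
    ≡⟨ adjs-segment A x (reverse (map negS B)) (negS x) C ⟩
      adjs (A ++ [ x ]) ++ adjs (x ∷ reverse (map negS B) ++ [ negS x ]) ++ adjs (negS x ∷ C)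
    ≡⟨ cong (λ zs → adjs (A ++ [ x ]) ++ zs ++ adjs (negS x ∷ C))
            (trans (cong adjs (sym (reverse-segment x B))) (adjs-reverse segment)) ⟩
      adjs (A ++ [ x ]) ++ map swap (reverse (adjs segment)) ++ adjs (negS x ∷ C)
    ∎
    where
    open ≡-Reasoning
    segment = x ∷ B ++ [ negS x ]

  split-at : ∀ (π : List (Signed {G} {R})) {k y} → lookupM π k ≡ just y →
    ∃[ B ] ∃[ C ] (π ≡ (B ++ [ y ]) ++ C × length (B ++ [ y ]) ≡ suc k)
  split-at (z ∷ π) {zero}  refl = [] , π , refl , refl
  split-at (z ∷ π) {suc k} πₖ with split-at π πₖ
  ... | B , C , refl , len = z ∷ B , C , refl , cong suc len

  decompose : ∀ (π : List (Signed {G} {R})) {i j x y} →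
    i < j → lookupM π i ≡ just x → lookupM π j ≡ just y →
    ∃[ A ] ∃[ B ] ∃[ C ] (π ≡ A ++ (x ∷ B ++ [ y ]) ++ C × length A ≡ i
                          × length (A ++ x ∷ B ++ [ y ]) ≡ suc j)
  decompose (z ∷ π) {zero} {suc j} _ refl πⱼ with split-at π πⱼ
  ... | B , C , refl , len = [] , B , C , refl , refl , cong suc len
  decompose (z ∷ π) {suc i} {suc j} (s≤s i<j) πᵢ πⱼ with decompose π i<j πᵢ πⱼ
  ... | A , B , C , refl , refl , len = z ∷ A , B , C , refl , refl , cong suc len

lemma7 : (G R : ℕ) (π τ : List (Signed {G} {R})) →
    IsChromosome π → IsChromosome τ → Simple π → Simple τ → SameAdj π τ →
    (∀ (r : Fin (suc R)) → countSym (rep r) π ≡ 2) →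
    (∀ (r : Fin (suc R)) → countSym (rep r) τ ≡ 2) →
    (∀ (r : Fin (suc R)) → ((true , rep r) ∈ τ) × ((false , rep r) ∈ τ)) →
    (i j : ℕ) (s : Bool) (r : Fin (suc R)) → i < j →
    lookupM π i ≡ just (s , rep r) → lookupM π j ≡ just (not s , rep r) →
    NMNS τ π ≤ NMNS τ (reversal i j π) + 1
lemma7 G R π τ _ _ _ simpleτ same _ _ _ i j s r i<j πᵢ πⱼ with decompose π i<j πᵢ πⱼ
... | A , B , C , refl , refl , lenAW = begin
    NMNS τ π
  ≡⟨ NMNS-split τ π P M S (adjs-segment A x B (negS x) C) ⟩
    rises (false ∷ flags P ++ flags M ++ flags S)
  ≤⟨ rises-mirror-infix false (flags P) (flags M) (flags S) ⟩
    suc (rises (false ∷ flags P ++ mirror (flags M) ++ flags S))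
  ≡⟨ cong (λ F → suc (rises (false ∷ flags P ++ F ++ flags S)))
          (sym (negativeFlags-reverse (adjs τ) M onceM)) ⟩
    suc (rises (false ∷ flags P ++ flags (map swap (reverse M)) ++ flags S))
  ≡⟨ cong suc (sym (NMNS-split τ π′ P (map swap (reverse M)) S (adjs-reversal A x B C refl lenAW))) ⟩
    suc (NMNS τ π′)
  ≡⟨ +-comm 1 (NMNS τ π′) ⟩
    NMNS τ π′ + 1
  ∎
  where
  open ≤-Reasoning
  x = (s , rep r)
  π′ = reversal (length A) j π
  P = adjs (A ++ [ x ])
  M = adjs (x ∷ B ++ [ negS x ])
  S = adjs (negS x ∷ C)
  flags = negativeFlags (adjs τ)
  onceM : All (λ q → countAdj q (adjs τ) ≡ 1) M
  onceM = ++⁻ˡ M (++⁻ʳ P (subst (All (λ q → countAdj q (adjs τ) ≡ 1)) (adjs-segment A x B (negS x) C)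
                                (occurs-once {σ = π} {τ} same simpleτ)))
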